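{- Let $G$ be a finite group, $H$ a proper subgroup of $G$, $C$ an inverse-closed subset of $G\setminus\{1\}$, and $\Gamma=\mathrm{Cay}(G,H,C)$. Then the number of edges of $\Gamma$ is \[|E(\Gamma)|=\frac{|H|\,(2|C|-|H\cap C|)}{2}.\]
   Context: $C$ inverse-closed means $C^{ -1}\subseteq C$. The relative Cayley graph $\Gamma=\mathrm{Cay}(G,H,C)$ is the simple graph with vertex set $G$ in which two distinct vertices $x,y$ are adjacent if and only if at least one of $x,y$ lies in $H$ and $x^{ -1}y\in C$. -}

module Defs where

open import Data.Nat using (ℕ; _<_; _<?_)
open import Data.Fin using (Fin; toℕ)
open import Data.Fin.Subset using (Subset; _∈_)
open import Data.Fin.Subset.Properties using (_∈?_)
open import Data.List using (List; length; filter; cartesianProduct; allFin)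
open import Data.Product using (_×_; _,_)
open import Data.Sum using (_⊎_)
open import Relation.Nullary.Decidable using (Dec; _×-dec_; _⊎-dec_)
open import Relation.Binary.PropositionalEquality using (_≡_)
open import Algebra.Core using (Op₁; Op₂)
open import Algebra.Structures using (IsGroup)

-- A finite group of order n is represented (up to isomorphism) by a group
-- structure on Fin n with propositional equality.
record FiniteGroup (n : ℕ) : Set where
  field
    _∙_     : Op₂ (Fin n)
    ε       : Fin n
    _⁻¹     : Op₁ (Fin n)
    isGroup : IsGroup _≡_ _∙_ ε _⁻¹
  infixl 7 _∙_
  infix 8 _⁻¹

module _ {n : ℕ} (G : FiniteGroup n) where
  open FiniteGroup G

  IsSubgroup : Subset n → Set
  IsSubgroup H = (ε ∈ H)
               × (∀ x y → x ∈ H → y ∈ H → (x ∙ y) ∈ H)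
               × (∀ x → x ∈ H → (x ⁻¹) ∈ H)

  IsProper : Subset n → Set
  IsProper H = Data.Product.∃ λ g → Data.Fin.Subset._∉_ g H

  InverseClosed : Subset n → Set
  InverseClosed C = ∀ x → x ∈ C → (x ⁻¹) ∈ C

  -- Adjacency in Cay(G,H,C) on a pair (x , y), counted once per unordered
  -- pair by requiring toℕ x < toℕ y (which also forces x ≠ y).
  EdgePair : Subset n → Subset n → Fin n × Fin n → Set
  EdgePair H C (x , y) = (toℕ x < toℕ y) × ((x ∈ H ⊎ y ∈ H) × ((x ⁻¹ ∙ y) ∈ C))

  edgePair? : (H C : Subset n) → (p : Fin n × Fin n) → Dec (EdgePair H C p)
  edgePair? H C (x , y) = (toℕ x <? toℕ y) ×-dec ((x ∈? H ⊎-dec y ∈? H) ×-dec ((x ⁻¹ ∙ y) ∈? C))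

  edgeCount : Subset n → Subset n → ℕ
  edgeCount H C = length (filter (edgePair? H C) (cartesianProduct (allFin n) (allFin n)))

-- Count ordered pairs instead of edges: 2|E| is the number of ordered pairs (x , y)
-- with x ∈ H or y ∈ H and x⁻¹y ∈ C, since that relation is symmetric (C = C⁻¹) and
-- irreflexive (1 ∉ C). By inclusion–exclusion this is
--   #{x ∈ H, x⁻¹y ∈ C} + #{y ∈ H, x⁻¹y ∈ C} − #{x, y ∈ H, x⁻¹y ∈ C}.
-- Left translation y ↦ x⁻¹y is a bijection of G, so the first two counts are |H||C|;
-- for x ∈ H it also maps H onto H, so the last count is |H||H ∩ C|.
module Submission where

open import Defs
open import Data.Nat using (ℕ; zero; suc; _+_; _*_; _∸_; _<?_)
open import Data.Nat.Properties
  using (+-*-semiring; +-identityʳ; *-assoc; *-distribˡ-+; *-distribʳ-+; *-distribˡ-∸; m+n∸n≡m)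
open import Data.Fin using (Fin; zero; suc; toℕ)
open import Data.Fin.Properties using (<-cmp)
open import Data.Fin.Subset using (Subset; _∈_; _∉_; ∣_∣; _∩_; inside; outside)
open import Data.Fin.Subset.Properties using (_∈?_; x∈p∩q⁺; x∈p∩q⁻)
open import Data.Vec using ([]; _∷_)
open import Data.Fin.Permutation using (Permutation; permutation)
open import Data.List using (List; []; _∷_; _++_; filter; length; tabulate; cartesianProduct; allFin)
open import Data.List.Properties using (filter-++; length-++)
import Data.List as List
open import Data.Bool using (true; false; if_then_else_)
open import Data.Product using (_×_; _,_; proj₁; proj₂)
open import Data.Sum using (_⊎_; swap)
open import Data.Empty using (⊥-elim)
open import Function using (_∘_; id)
open import Relation.Nullary using (Dec; yes; no; does; ¬_)
open import Relation.Nullary.Decidable using (_×-dec_; _⊎-dec_)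
open import Relation.Unary using (Pred; Decidable)
open import Relation.Binary.Definitions using (tri<; tri≈; tri>)
open import Relation.Binary.PropositionalEquality
open import Algebra.Bundles using (Group)
import Algebra.Properties.Group as GroupProperties
open import Algebra.Properties.Semiring.Sum +-*-semiring
  using (sum; sum-syntax; ∑-comm; ∑-distrib-+; sum-cong-≗; sum-permute; *-distribˡ-sum; *-distribʳ-sum)

iverson : ∀ {p} {P : Set p} → Dec P → ℕ
iverson d = if does d then 1 else 0

module _ {p q} {P : Set p} {Q : Set q} where

  iverson-cong : (P → Q) → (Q → P) → (a : Dec P) (b : Dec Q) → iverson a ≡ iverson b
  iverson-cong _   _   (yes _) (yes _) = refl
  iverson-cong P⇒Q _   (yes a) (no ¬b) = ⊥-elim (¬b (P⇒Q a))
  iverson-cong _   Q⇒P (no ¬a) (yes b) = ⊥-elim (¬a (Q⇒P b))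
  iverson-cong _   _   (no _)  (no _)  = refl

  iverson-× : (a : Dec P) (b : Dec Q) → iverson (a ×-dec b) ≡ iverson a * iverson b
  iverson-× (yes _) (yes _) = refl
  iverson-× (yes _) (no _)  = refl
  iverson-× (no _)  _       = refl

  iverson-⊎ : (a : Dec P) (b : Dec Q) → iverson (a ⊎-dec b) + iverson a * iverson b ≡ iverson a + iverson b
  iverson-⊎ (yes _) (yes _) = refl
  iverson-⊎ (yes _) (no _)  = refl
  iverson-⊎ (no _)  (yes _) = refl
  iverson-⊎ (no _)  (no _)  = refl

iverson-yes : ∀ {p} {P : Set p} → P → (a : Dec P) → iverson a ≡ 1
iverson-yes _  (yes _) = refl
iverson-yes px (no ¬p) = ⊥-elim (¬p px)

iverson-no : ∀ {p} {P : Set p} → ¬ P → (a : Dec P) → iverson a ≡ 0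
iverson-no ¬p (yes px) = ⊥-elim (¬p px)
iverson-no _  (no _)   = refl

∣p∣≡∑∈ : ∀ {m} (p : Subset m) → ∣ p ∣ ≡ ∑[ i < m ] iverson (i ∈? p)
∣p∣≡∑∈ []            = refl
∣p∣≡∑∈ (inside ∷ p)  = cong suc (∣p∣≡∑∈ p)
∣p∣≡∑∈ (outside ∷ p) = ∣p∣≡∑∈ p

module _ {a p} {A : Set a} {P : Pred A p} (P? : Decidable P) where

  length-filter-map : ∀ {b} {B : Set b} (f : B → A) (xs : List B) →
                      length (filter P? (List.map f xs)) ≡ length (filter (P? ∘ f) xs)
  length-filter-map f []       = refl
  length-filter-map f (x ∷ xs) with does (P? (f x))
  ... | true  = cong suc (length-filter-map f xs)
  ... | false = length-filter-map f xs

  length-filter-tabulate : ∀ {m} (f : Fin m → A) →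
                           length (filter P? (tabulate f)) ≡ ∑[ i < m ] iverson (P? (f i))
  length-filter-tabulate {zero}  f = refl
  length-filter-tabulate {suc m} f with does (P? (f zero))
  ... | true  = cong suc (length-filter-tabulate (f ∘ suc))
  ... | false = length-filter-tabulate (f ∘ suc)

length-filter-cartesianProduct :
  ∀ {a b p} {A : Set a} {B : Set b} {P : Pred (A × B) p} (P? : Decidable P)
  {m} (f : Fin m → A) (ys : List B) →
  length (filter P? (cartesianProduct (tabulate f) ys))
    ≡ ∑[ i < m ] length (filter (λ y → P? (f i , y)) ys)
length-filter-cartesianProduct P? {zero}  f ys = refl
length-filter-cartesianProduct {A = A} {B = B} P? {suc m} f ys = begin
  length (filter P? (List.map (f zero ,_) ys ++ rest))
    ≡⟨ cong length (filter-++ P? (List.map (f zero ,_) ys) rest) ⟩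
  length (filter P? (List.map (f zero ,_) ys) ++ filter P? rest)
    ≡⟨ length-++ (filter P? (List.map (f zero ,_) ys)) ⟩
  length (filter P? (List.map (f zero ,_) ys)) + length (filter P? rest)
    ≡⟨ cong₂ _+_ (length-filter-map P? (f zero ,_) ys)
                 (length-filter-cartesianProduct P? (f ∘ suc) ys) ⟩
  length (filter (λ y → P? (f zero , y)) ys) + ∑[ i < m ] length (filter (λ y → P? (f (suc i) , y)) ys)
    ∎
  where
  open ≡-Reasoning
  rest : List (A × B)
  rest = cartesianProduct (tabulate (f ∘ suc)) ys

∑∑-distrib-+ : ∀ {m n} (f g : Fin m → Fin n → ℕ) →
               ∑[ x < m ] ∑[ y < n ] (f x y + g x y)
                 ≡ ∑[ x < m ] ∑[ y < n ] f x y + ∑[ x < m ] ∑[ y < n ] g x y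
∑∑-distrib-+ f g = trans (sum-cong-≗ (λ x → ∑-distrib-+ (f x) (g x)))
                         (∑-distrib-+ (λ x → sum (f x)) (λ x → sum (g x)))

2*∑∑<≡∑∑ : ∀ {n} (f : Fin n → Fin n → ℕ) → (∀ x y → f x y ≡ f y x) → (∀ x → f x x ≡ 0) →
           2 * ∑[ x < n ] ∑[ y < n ] (iverson (toℕ x <? toℕ y) * f x y)
             ≡ ∑[ x < n ] ∑[ y < n ] f x y
2*∑∑<≡∑∑ {n} f sym-f diag-f = begin
  2 * S                                          ≡⟨ cong (S +_) (+-identityʳ S) ⟩
  S + S                                          ≡⟨ cong (S +_) (∑-comm g) ⟩
  S + ∑[ x < n ] ∑[ y < n ] g y x                ≡⟨ ∑∑-distrib-+ g (λ x y → g y x) ⟨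
  ∑[ x < n ] ∑[ y < n ] (g x y + g y x)          ≡⟨ sum-cong-≗ (λ x → sum-cong-≗ (pair x)) ⟩
  ∑[ x < n ] ∑[ y < n ] f x y                    ∎
  where
  open ≡-Reasoning
  g : Fin n → Fin n → ℕ
  g x y = iverson (toℕ x <? toℕ y) * f x y
  S : ℕ
  S = ∑[ x < n ] ∑[ y < n ] g x y
  pair : ∀ x y → g x y + g y x ≡ f x y
  pair x y with <-cmp x y
  ... | tri< x<y _ y≮x rewrite iverson-yes x<y (toℕ x <? toℕ y) | iverson-no y≮x (toℕ y <? toℕ x)
    = trans (+-identityʳ _) (+-identityʳ _)
  ... | tri> x≮y _ y<x rewrite iverson-no x≮y (toℕ x <? toℕ y) | iverson-yes y<x (toℕ y <? toℕ x)
    = trans (+-identityʳ _) (sym (sym-f x y))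
  ... | tri≈ x≮y refl _ rewrite iverson-no x≮y (toℕ x <? toℕ x) = sym (diag-f x)

module Translation {n : ℕ} (G : FiniteGroup n) where
  open FiniteGroup G

  group : Group _ _
  group = record { isGroup = isGroup }

  open GroupProperties group using (\\-leftDividesˡ; \\-leftDividesʳ)

  translation : Fin n → Permutation n n
  translation x = permutation (x ⁻¹ ∙_) (x ∙_) (\\-leftDividesʳ x) (\\-leftDividesˡ x)

  ∑-translate : ∀ x (g : Fin n → ℕ) → ∑[ y < n ] g (x ⁻¹ ∙ y) ≡ sum g
  ∑-translate x g = sym (sum-permute g (translation x))

  ∑∑-translate : (H : Subset n) (g : Fin n → ℕ) →
                 ∑[ x < n ] ∑[ y < n ] (iverson (x ∈? H) * g (x ⁻¹ ∙ y)) ≡ ∣ H ∣ * sum g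
  ∑∑-translate H g = begin
    ∑[ x < n ] ∑[ y < n ] (hI x * g (x ⁻¹ ∙ y))
      ≡⟨ sum-cong-≗ (λ x → *-distribˡ-sum {n} (hI x) (λ y → g (x ⁻¹ ∙ y))) ⟨
    ∑[ x < n ] (hI x * ∑[ y < n ] g (x ⁻¹ ∙ y))
      ≡⟨ sum-cong-≗ (λ x → cong (hI x *_) (∑-translate x g)) ⟩
    ∑[ x < n ] (hI x * sum g)
      ≡⟨ *-distribʳ-sum {n} (sum g) hI ⟨
    sum hI * sum g
      ≡⟨ cong (_* sum g) (∣p∣≡∑∈ H) ⟨
    ∣ H ∣ * sum g
      ∎
    where
    open ≡-Reasoning
    hI : Fin n → ℕ
    hI x = iverson (x ∈? H)

  module _ (H : Subset n) (H≤G : IsSubgroup G H) where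
    private
      hI : Fin n → ℕ
      hI x = iverson (x ∈? H)

      ∙-closed : ∀ x y → x ∈ H → y ∈ H → (x ∙ y) ∈ H
      ∙-closed = proj₁ (proj₂ H≤G)

      ⁻¹-closed : ∀ x → x ∈ H → (x ⁻¹) ∈ H
      ⁻¹-closed = proj₂ (proj₂ H≤G)

    iverson-∈-translate : ∀ {x} → x ∈ H → ∀ y → hI y ≡ hI (x ⁻¹ ∙ y)
    iverson-∈-translate {x} x∈H y = iverson-cong
      (λ y∈H → ∙-closed _ _ (⁻¹-closed x x∈H) y∈H)
      (λ x⁻¹y∈H → subst (_∈ H) (\\-leftDividesˡ x y) (∙-closed _ _ x∈H x⁻¹y∈H))
      (y ∈? H) ((x ⁻¹ ∙ y) ∈? H)

    ∑∑-translate-subgroup : (g : Fin n → ℕ) →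
      ∑[ x < n ] ∑[ y < n ] (hI x * hI y * g (x ⁻¹ ∙ y)) ≡ ∣ H ∣ * ∑[ z < n ] (hI z * g z)
    ∑∑-translate-subgroup g = begin
      ∑[ x < n ] ∑[ y < n ] (hI x * hI y * g (x ⁻¹ ∙ y))
        ≡⟨ sum-cong-≗ (λ x → sum-cong-≗ (λ y → *-assoc (hI x) (hI y) _)) ⟩
      ∑[ x < n ] ∑[ y < n ] (hI x * (hI y * g (x ⁻¹ ∙ y)))
        ≡⟨ sum-cong-≗ (λ x → sum-cong-≗ (hI-translate x)) ⟩
      ∑[ x < n ] ∑[ y < n ] (hI x * (hI (x ⁻¹ ∙ y) * g (x ⁻¹ ∙ y)))
        ≡⟨ ∑∑-translate H (λ z → hI z * g z) ⟩
      ∣ H ∣ * ∑[ z < n ] (hI z * g z)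
        ∎
      where
      open ≡-Reasoning
      hI-translate : ∀ x y → hI x * (hI y * g (x ⁻¹ ∙ y)) ≡ hI x * (hI (x ⁻¹ ∙ y) * g (x ⁻¹ ∙ y))
      hI-translate x y with x ∈? H
      ... | yes x∈H = cong (λ h → 1 * (h * g (x ⁻¹ ∙ y))) (iverson-∈-translate x∈H y)
      ... | no _    = refl

module EdgeCount {n : ℕ} (G : FiniteGroup n) (H C : Subset n)
  (H≤G : IsSubgroup G H) (C⁻¹⊆C : InverseClosed G C) (ε∉C : FiniteGroup.ε G ∉ C) where
  open FiniteGroup G
  open Translation G
  open Group group using (inverseˡ)
  open GroupProperties group using (⁻¹-anti-homo-\\)

  hI cI : Fin n → ℕ
  hI x = iverson (x ∈? H)
  cI x = iverson (x ∈? C)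

  Adjacent? : ∀ x y → Dec ((x ∈ H ⊎ y ∈ H) × ((x ⁻¹ ∙ y) ∈ C))
  Adjacent? x y = (x ∈? H ⊎-dec y ∈? H) ×-dec ((x ⁻¹ ∙ y) ∈? C)

  adj : Fin n → Fin n → ℕ
  adj x y = iverson (Adjacent? x y)

  ∈C-swap : ∀ x y → (x ⁻¹ ∙ y) ∈ C → (y ⁻¹ ∙ x) ∈ C
  ∈C-swap x y c = subst (_∈ C) (⁻¹-anti-homo-\\ x y) (C⁻¹⊆C _ c)

  cI-swap : ∀ x y → cI (x ⁻¹ ∙ y) ≡ cI (y ⁻¹ ∙ x)
  cI-swap x y = iverson-cong (∈C-swap x y) (∈C-swap y x) ((x ⁻¹ ∙ y) ∈? C) ((y ⁻¹ ∙ x) ∈? C)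

  adj-sym : ∀ x y → adj x y ≡ adj y x
  adj-sym x y = iverson-cong (λ (h , c) → swap h , ∈C-swap x y c)
                             (λ (h , c) → swap h , ∈C-swap y x c)
                             (Adjacent? x y) (Adjacent? y x)

  adj-irrefl : ∀ x → adj x x ≡ 0
  adj-irrefl x = iverson-no (λ (_ , c) → ε∉C (subst (_∈ C) (inverseˡ x) c)) (Adjacent? x x)

  2*edgeCount≡∑∑adj : 2 * edgeCount G H C ≡ ∑[ x < n ] ∑[ y < n ] adj x y
  2*edgeCount≡∑∑adj = begin
    2 * edgeCount G H C
      ≡⟨ cong (2 *_) (length-filter-cartesianProduct (edgePair? G H C) id (allFin n)) ⟩
    2 * ∑[ x < n ] length (filter (λ y → edgePair? G H C (x , y)) (allFin n))
      ≡⟨ cong (2 *_) (sum-cong-≗ (λ x → length-filter-tabulate (λ y → edgePair? G H C (x , y)) id)) ⟩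
    2 * ∑[ x < n ] ∑[ y < n ] iverson (edgePair? G H C (x , y))
      ≡⟨ cong (2 *_) (sum-cong-≗ (λ x → sum-cong-≗ (λ y → iverson-× (toℕ x <? toℕ y) (Adjacent? x y)))) ⟩
    2 * ∑[ x < n ] ∑[ y < n ] (iverson (toℕ x <? toℕ y) * adj x y)
      ≡⟨ 2*∑∑<≡∑∑ adj adj-sym adj-irrefl ⟩
    ∑[ x < n ] ∑[ y < n ] adj x y
      ∎
    where open ≡-Reasoning

  inclusion-exclusion : ∀ x y → adj x y + hI x * hI y * cI (x ⁻¹ ∙ y)
                                ≡ hI x * cI (x ⁻¹ ∙ y) + hI y * cI (x ⁻¹ ∙ y)
  inclusion-exclusion x y = begin
    adj x y + hI x * hI y * c               ≡⟨ cong (_+ hI x * hI y * c) (iverson-× H∪? C?) ⟩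
    iverson H∪? * c + hI x * hI y * c       ≡⟨ *-distribʳ-+ c (iverson H∪?) (hI x * hI y) ⟨
    (iverson H∪? + hI x * hI y) * c         ≡⟨ cong (_* c) (iverson-⊎ (x ∈? H) (y ∈? H)) ⟩
    (hI x + hI y) * c                       ≡⟨ *-distribʳ-+ c (hI x) (hI y) ⟩
    hI x * c + hI y * c                     ∎
    where
    open ≡-Reasoning
    c : ℕ
    c = cI (x ⁻¹ ∙ y)
    H∪? : Dec (x ∈ H ⊎ y ∈ H)
    H∪? = x ∈? H ⊎-dec y ∈? H
    C? : Dec ((x ⁻¹ ∙ y) ∈ C)
    C? = (x ⁻¹ ∙ y) ∈? C

  ∑∑-head-in-H : ∑[ x < n ] ∑[ y < n ] (hI x * cI (x ⁻¹ ∙ y)) ≡ ∣ H ∣ * ∣ C ∣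
  ∑∑-head-in-H = trans (∑∑-translate H cI) (cong (∣ H ∣ *_) (sym (∣p∣≡∑∈ C)))

  ∑∑-tail-in-H : ∑[ x < n ] ∑[ y < n ] (hI y * cI (x ⁻¹ ∙ y)) ≡ ∣ H ∣ * ∣ C ∣
  ∑∑-tail-in-H = begin
    ∑[ x < n ] ∑[ y < n ] (hI y * cI (x ⁻¹ ∙ y))
      ≡⟨ sum-cong-≗ (λ x → sum-cong-≗ (λ y → cong (hI y *_) (cI-swap x y))) ⟩
    ∑[ x < n ] ∑[ y < n ] (hI y * cI (y ⁻¹ ∙ x))
      ≡⟨ ∑-comm (λ x y → hI y * cI (y ⁻¹ ∙ x)) ⟩
    ∑[ y < n ] ∑[ x < n ] (hI y * cI (y ⁻¹ ∙ x))
      ≡⟨ ∑∑-head-in-H ⟩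
    ∣ H ∣ * ∣ C ∣
      ∎
    where open ≡-Reasoning

  ∑∑-both-in-H : ∑[ x < n ] ∑[ y < n ] (hI x * hI y * cI (x ⁻¹ ∙ y)) ≡ ∣ H ∣ * ∣ H ∩ C ∣
  ∑∑-both-in-H = trans (∑∑-translate-subgroup H H≤G cI) (cong (∣ H ∣ *_) (begin
    ∑[ z < n ] (hI z * cI z)                  ≡⟨ sum-cong-≗ (λ z → iverson-× (z ∈? H) (z ∈? C)) ⟨
    ∑[ z < n ] iverson (z ∈? H ×-dec z ∈? C)  ≡⟨ sum-cong-≗ ∈∩-iverson ⟩
    ∑[ z < n ] iverson (z ∈? H ∩ C)           ≡⟨ ∣p∣≡∑∈ (H ∩ C) ⟨
    ∣ H ∩ C ∣                                 ∎))
    where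
    open ≡-Reasoning
    ∈∩-iverson : ∀ z → iverson (z ∈? H ×-dec z ∈? C) ≡ iverson (z ∈? H ∩ C)
    ∈∩-iverson z = iverson-cong x∈p∩q⁺ (x∈p∩q⁻ H C) (z ∈? H ×-dec z ∈? C) (z ∈? H ∩ C)

  ∑∑adj+∣H∣∣H∩C∣ : ∑[ x < n ] ∑[ y < n ] adj x y + ∣ H ∣ * ∣ H ∩ C ∣ ≡ ∣ H ∣ * (2 * ∣ C ∣)
  ∑∑adj+∣H∣∣H∩C∣ = begin
    ∑∑ adj + ∣ H ∣ * ∣ H ∩ C ∣
      ≡⟨ cong (∑∑ adj +_) ∑∑-both-in-H ⟨
    ∑∑ adj + ∑∑ (λ x y → hI x * hI y * cI (x ⁻¹ ∙ y))
      ≡⟨ ∑∑-distrib-+ adj (λ x y → hI x * hI y * cI (x ⁻¹ ∙ y)) ⟨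
    ∑∑ (λ x y → adj x y + hI x * hI y * cI (x ⁻¹ ∙ y))
      ≡⟨ sum-cong-≗ (λ x → sum-cong-≗ (inclusion-exclusion x)) ⟩
    ∑∑ (λ x y → hI x * cI (x ⁻¹ ∙ y) + hI y * cI (x ⁻¹ ∙ y))
      ≡⟨ ∑∑-distrib-+ (λ x y → hI x * cI (x ⁻¹ ∙ y)) (λ x y → hI y * cI (x ⁻¹ ∙ y)) ⟩
    ∑∑ (λ x y → hI x * cI (x ⁻¹ ∙ y)) + ∑∑ (λ x y → hI y * cI (x ⁻¹ ∙ y))
      ≡⟨ cong₂ _+_ ∑∑-head-in-H ∑∑-tail-in-H ⟩
    ∣ H ∣ * ∣ C ∣ + ∣ H ∣ * ∣ C ∣
      ≡⟨ cong (λ k → ∣ H ∣ * ∣ C ∣ + ∣ H ∣ * k) (+-identityʳ ∣ C ∣) ⟨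
    ∣ H ∣ * ∣ C ∣ + ∣ H ∣ * (∣ C ∣ + 0)
      ≡⟨ *-distribˡ-+ ∣ H ∣ ∣ C ∣ (∣ C ∣ + 0) ⟨
    ∣ H ∣ * (2 * ∣ C ∣)
      ∎
    where
    open ≡-Reasoning
    ∑∑ : (Fin n → Fin n → ℕ) → ℕ
    ∑∑ f = ∑[ x < n ] ∑[ y < n ] f x y

mainTheorem11 : (n : ℕ) (G : FiniteGroup n) (H C : Subset n)
    → IsSubgroup G H → IsProper G H
    → InverseClosed G C → FiniteGroup.ε G ∉ C
    → 2 * edgeCount G H C ≡ ∣ H ∣ * (2 * ∣ C ∣ ∸ ∣ H ∩ C ∣)
mainTheorem11 n G H C H≤G _ C⁻¹⊆C ε∉C = begin
  2 * edgeCount G H C                    ≡⟨ 2*edgeCount≡∑∑adj ⟩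
  T                                      ≡⟨ m+n∸n≡m T K ⟨
  T + K ∸ K                              ≡⟨ cong (_∸ K) ∑∑adj+∣H∣∣H∩C∣ ⟩
  ∣ H ∣ * (2 * ∣ C ∣) ∸ K                ≡⟨ *-distribˡ-∸ ∣ H ∣ (2 * ∣ C ∣) (∣ H ∩ C ∣) ⟨
  ∣ H ∣ * (2 * ∣ C ∣ ∸ ∣ H ∩ C ∣)        ∎
  where
  open ≡-Reasoning
  open EdgeCount G H C H≤G C⁻¹⊆C ε∉C
  T K : ℕ
  T = ∑[ x < n ] ∑[ y < n ] adj x y
  K = ∣ H ∣ * ∣ H ∩ C ∣
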